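{- For any positive integer $v \equiv 1,3 \pmod 6$, we have \[ f(v) \leq \frac{2v+5-\sqrt{24v+25}}{2}. \]
   Context: A Steiner triple system of order $v$ (STS$(v)$) is a pair $(X,\mathcal{B})$ where $X$ is a set of $v$ points and $\mathcal{B}$ is a set of $3$-element subsets of $X$ (blocks) such that every pair of distinct points of $X$ is contained in exactly one block. For $Y \subseteq X$ and $\mathcal{C} \subseteq \mathcal{B}$, the pair $(Y,\mathcal{C})$ is a nonincident set of points and blocks if $y \notin B$ for all $y \in Y$ and all $B \in \mathcal{C}$. $f(v)$ denotes the maximum integer $s$ such that there exists a nonincident set of $s$ points and $s$ blocks in some STS$(v)$. -}

module Defs where

open import Data.Nat using (ℕ; _+_; _*_; _∸_; _^_; _≤_)
open import Data.Fin using (Fin)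
open import Data.Fin.Subset using (Subset; _∈_; _∉_; ∣_∣)
open import Data.Product using (Σ; _×_; ∃-syntax)
open import Relation.Binary.PropositionalEquality using (_≡_; _≢_)
open import Function.Definitions using (Injective)

-- The block set is given as an indexed family of b distinct subsets of Fin v
-- (injectivity = the blocks form a *set*), each of size 3, such that every
-- pair of distinct points lies in exactly one block.
record STS (v : ℕ) : Set where
  field
    b          : ℕ
    block      : Fin b → Subset v
    distinct   : Injective _≡_ _≡_ block
    triple     : ∀ i → ∣ block i ∣ ≡ 3
    pairUnique : ∀ (x y : Fin v) → x ≢ y →
                 ∃[ i ] ((x ∈ block i × y ∈ block i) ×
                         (∀ j → x ∈ block j → y ∈ block j → j ≡ i))

Nonincident : ∀ {v} (S : STS v) → Subset v → Subset (STS.b S) → Set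
Nonincident {v} S Y C =
  ∀ (y : Fin v) (i : Fin (STS.b S)) → y ∈ Y → i ∈ C → y ∉ STS.block S i

-- s ≤ (2v + 5 - √(24v+25)) / 2, expressed without reals:
-- equivalent to  0 ≤ 2v+5-2s  and  24v+25 ≤ (2v+5-2s)².
BoundHolds : ℕ → ℕ → Set
BoundHolds v s = (2 * s ≤ 2 * v + 5) × (24 * v + 25 ≤ (2 * v + 5 ∸ 2 * s) ^ 2)

-- For a point x outside Y, the blocks of C through x meet only in x and, by
-- nonincidence, avoid Y; so they cover 2·deg x + 1 ≤ w points, where w = v − |Y|.
-- Summing over the w points outside Y, and using Σ deg = 3|C|, gives 6s + w ≤ w²
-- for |Y| = |C| = s.  Since v = s + w this is exactly
-- (2v + 5 − 2s)² − (24v + 25) = 4(w² − 6s − w) ≥ 0.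
module Submission where

open import Defs
open import Data.Nat using (ℕ; _%_; _≤_)
open import Data.Fin.Subset using (Subset; ∣_∣)
open import Data.Sum using (_⊎_)
open import Relation.Binary.PropositionalEquality using (_≡_)

open import Data.Bool.Base using (true; false; if_then_else_)
open import Data.Fin.Base using (Fin; zero; suc; punchIn)
open import Data.Fin.Properties using (punchInᵢ≢i)
open import Data.Fin.Subset using (_∈_; _∉_; ∁)
open import Data.Fin.Subset.Properties using (_∈?_; x∉p⇒x∈∁p; x∈p⇒x∉∁p; ∣∁p∣≡n∸∣p∣; ∣p∣≤n)
open import Data.Nat.Base using (suc; _+_; _*_; _∸_; _^_; z≤n)
open import Data.Nat.Properties
open import Data.Nat.Solver using (module +-*-Solver)
open import Data.Product using (_,_)
open import Data.Vec.Base using (_∷_; []; lookup)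
open import Data.Vec.Properties using ([]=⇒lookup; lookup⇒[]=)
open import Function.Base using (_∘_)
open import Relation.Nullary using (Dec; yes; no; contradiction)
open import Relation.Binary.PropositionalEquality using (_≢_; refl; sym; trans; cong; cong₂; subst; module ≡-Reasoning)
open import Algebra.Properties.Semiring.Sum +-*-semiring

open +-*-Solver

sum-mono-≤ : ∀ {n} {f g : Fin n → ℕ} → (∀ i → f i ≤ g i) → sum f ≤ sum g
sum-mono-≤ {0}     f≤g = z≤n
sum-mono-≤ {suc n} f≤g = +-mono-≤ (f≤g zero) (sum-mono-≤ (f≤g ∘ suc))

sum-zero : ∀ {n} {f : Fin n → ℕ} → (∀ i → f i ≡ 0) → sum f ≡ 0
sum-zero {n} f≡0 = trans (sum-cong-≗ f≡0) (sum-replicate-zero n)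

sum-mono-≤-except : ∀ {n} (i : Fin n) {f g : Fin n → ℕ} →
                    (∀ j → j ≢ i → f j ≤ g j) → sum f + g i ≤ sum g + f i
sum-mono-≤-except {suc n} i {f} {g} f≤g = begin
  sum f + g i               ≡⟨ cong (_+ g i) (sum-remove {i = i} f) ⟩
  f i + sum f∖i + g i       ≤⟨ +-monoˡ-≤ (g i) (+-monoʳ-≤ (f i) f∖i≤g∖i) ⟩
  f i + sum g∖i + g i       ≡⟨ solve 3 (λ a b c → a :+ b :+ c := c :+ b :+ a) refl (f i) (sum g∖i) (g i) ⟩
  g i + sum g∖i + f i       ≡⟨ cong (_+ f i) (sum-remove {i = i} g) ⟨
  sum g + f i               ∎
  where
  open ≤-Reasoning
  f∖i g∖i : Fin n → ℕ
  f∖i = f ∘ punchIn i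
  g∖i = g ∘ punchIn i
  f∖i≤g∖i : sum f∖i ≤ sum g∖i
  f∖i≤g∖i = sum-mono-≤ (λ j → f≤g _ (punchInᵢ≢i i j))

sum-≤-single : ∀ {n} (i : Fin n) {f : Fin n → ℕ} → (∀ j → j ≢ i → f j ≡ 0) → sum f ≤ f i
sum-≤-single {n} i {f} f≡0 = begin
  sum f                       ≡⟨ +-identityʳ (sum f) ⟨
  sum f + 0                   ≤⟨ sum-mono-≤-except i (λ j j≢i → ≤-reflexive (f≡0 j j≢i)) ⟩
  sum {n} (λ _ → 0) + f i     ≡⟨ cong (_+ f i) (sum-replicate-zero n) ⟩
  f i                         ∎
  where open ≤-Reasoning

χ : ∀ {n} → Subset n → Fin n → ℕ
χ p i = if lookup p i then 1 else 0

module _ {n} {p : Subset n} {i : Fin n} where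

  χ-∈ : i ∈ p → χ p i ≡ 1
  χ-∈ i∈p rewrite []=⇒lookup i∈p = refl

  χ-∉ : i ∉ p → χ p i ≡ 0
  χ-∉ i∉p with lookup p i in eq
  ... | true  = contradiction (lookup⇒[]= i p eq) i∉p
  ... | false = refl

  χ≤1 : χ p i ≤ 1
  χ≤1 with lookup p i
  ... | true  = ≤-refl
  ... | false = z≤n

  χ*χ≡χ : χ p i * χ p i ≡ χ p i
  χ*χ≡χ with lookup p i
  ... | true  = refl
  ... | false = refl

∣p∣≡sum-χ : ∀ {n} (p : Subset n) → ∣ p ∣ ≡ sum (χ p)
∣p∣≡sum-χ []          = refl
∣p∣≡sum-χ (true ∷ p)  = cong suc (∣p∣≡sum-χ p)
∣p∣≡sum-χ (false ∷ p) = ∣p∣≡sum-χ p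

module Counting {v} (S : STS v) (C : Subset (STS.b S)) where
  open STS S

  degree : Fin v → ℕ
  degree x = ∑[ i < b ] (χ C i * χ (block i) x)

  common : Fin v → Fin v → ℕ
  common x y = ∑[ i < b ] (χ C i * χ (block i) x * χ (block i) y)

  common-diag : ∀ x → common x x ≡ degree x
  common-diag x = sum-cong-≗ λ i →
    trans (*-assoc (χ C i) _ _) (cong (χ C i *_) (χ*χ≡χ {p = block i}))

  common≤1 : ∀ {x y} → x ≢ y → common x y ≤ 1
  common≤1 {x} {y} x≢y with pairUnique x y x≢y
  ... | i₀ , _ , unique = ≤-trans (sum-≤-single i₀ off-i₀) at-i₀
    where
    at-i₀ : χ C i₀ * χ (block i₀) x * χ (block i₀) y ≤ 1
    at-i₀ = *-mono-≤ (*-mono-≤ (χ≤1 {p = C}) (χ≤1 {p = block i₀})) (χ≤1 {p = block i₀})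
    off-i₀ : ∀ j → j ≢ i₀ → χ C j * χ (block j) x * χ (block j) y ≡ 0
    off-i₀ j j≢i₀ with x ∈? block j | y ∈? block j
    ... | yes x∈j | yes y∈j = contradiction (unique j x∈j y∈j) j≢i₀
    ... | no x∉j  | _       rewrite χ-∉ x∉j = cong (_* χ (block j) y) (*-zeroʳ (χ C j))
    ... | yes _   | no y∉j  rewrite χ-∉ y∉j = *-zeroʳ (χ C j * χ (block j) x)

  sum-block : ∀ (a : Fin b → ℕ) → ∑[ y < v ] ∑[ i < b ] (a i * χ (block i) y) ≡ sum a * 3
  sum-block a = begin
    ∑[ y < v ] ∑[ i < b ] (a i * χ (block i) y)  ≡⟨ ∑-comm (λ i y → a i * χ (block i) y) ⟨
    ∑[ i < b ] ∑[ y < v ] (a i * χ (block i) y)  ≡⟨ sum-cong-≗ (λ i → *-distribˡ-sum (a i) (χ (block i))) ⟨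
    ∑[ i < b ] (a i * sum (χ (block i)))         ≡⟨ sum-cong-≗ (λ i → cong (a i *_) (trans (sym (∣p∣≡sum-χ (block i))) (triple i))) ⟩
    ∑[ i < b ] (a i * 3)                         ≡⟨ *-distribʳ-sum 3 a ⟨
    sum a * 3                                    ∎
    where open ≡-Reasoning

  sum-degree : sum degree ≡ ∣ C ∣ * 3
  sum-degree = trans (sum-block (χ C)) (cong (_* 3) (sym (∣p∣≡sum-χ C)))

  sum-common : ∀ x → sum (common x) ≡ degree x * 3
  sum-common x = sum-block (λ i → χ C i * χ (block i) x)

  module _ {Y : Subset v} (nonincident : Nonincident S Y C) where

    common-∈ : ∀ x {y} → y ∈ Y → common x y ≡ 0
    common-∈ x {y} y∈Y = sum-zero λ i → term-vanishes i (i ∈? C)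
      where
      term-vanishes : ∀ i → Dec (i ∈ C) → χ C i * χ (block i) x * χ (block i) y ≡ 0
      term-vanishes i (yes i∈C) rewrite χ-∉ (nonincident y i y∈Y i∈C) = *-zeroʳ (χ C i * χ (block i) x)
      term-vanishes i (no i∉C)  rewrite χ-∉ i∉C = refl

    degree-∈ : ∀ {x} → x ∈ Y → degree x ≡ 0
    degree-∈ {x} x∈Y = trans (sym (common-diag x)) (common-∈ x x∈Y)

    common≤χ∁ : ∀ {x y} → x ≢ y → common x y ≤ χ (∁ Y) y
    common≤χ∁ {x} {y} x≢y with y ∈? Y
    ... | yes y∈Y = ≤-trans (≤-reflexive (common-∈ x y∈Y)) z≤n
    ... | no y∉Y  = ≤-trans (common≤1 x≢y) (≤-reflexive (sym (χ-∈ (x∉p⇒x∈∁p y∉Y))))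

    degree-bound : ∀ {x} → x ∉ Y → 2 * degree x + 1 ≤ ∣ ∁ Y ∣
    degree-bound {x} x∉Y = +-cancelˡ-≤ (degree x) _ _ (begin
      degree x + (2 * degree x + 1)  ≡⟨ solve 1 (λ d → d :+ (con 2 :* d :+ con 1) := d :* con 3 :+ con 1) refl (degree x) ⟩
      degree x * 3 + 1               ≡⟨ cong₂ _+_ (sym (sum-common x)) (sym (χ-∈ (x∉p⇒x∈∁p x∉Y))) ⟩
      sum (common x) + χ (∁ Y) x     ≤⟨ sum-mono-≤-except x (λ y y≢x → common≤χ∁ (y≢x ∘ sym)) ⟩
      sum (χ (∁ Y)) + common x x     ≡⟨ cong₂ _+_ (sym (∣p∣≡sum-χ (∁ Y))) (common-diag x) ⟩
      ∣ ∁ Y ∣ + degree x             ≡⟨ +-comm ∣ ∁ Y ∣ (degree x) ⟩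
      degree x + ∣ ∁ Y ∣             ∎)
      where open ≤-Reasoning

    weighted-degree-bound : ∀ x → 2 * degree x + χ (∁ Y) x ≤ χ (∁ Y) x * ∣ ∁ Y ∣
    weighted-degree-bound x with x ∈? Y
    ... | yes x∈Y rewrite degree-∈ x∈Y | χ-∉ (x∈p⇒x∉∁p x∈Y) = z≤n
    ... | no x∉Y  rewrite χ-∈ (x∉p⇒x∈∁p x∉Y) | +-identityʳ ∣ ∁ Y ∣ = degree-bound x∉Y

    count-bound : 6 * ∣ C ∣ + ∣ ∁ Y ∣ ≤ ∣ ∁ Y ∣ * ∣ ∁ Y ∣
    count-bound = begin
      6 * ∣ C ∣ + w                             ≡⟨ cong₂ _+_ 6∣C∣≡2∑degree (∣p∣≡sum-χ (∁ Y)) ⟩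
      2 * sum degree + sum (χ (∁ Y))            ≡⟨ cong (_+ sum (χ (∁ Y))) (*-distribˡ-sum 2 degree) ⟩
      sum (λ x → 2 * degree x) + sum (χ (∁ Y))  ≡⟨ ∑-distrib-+ (λ x → 2 * degree x) (χ (∁ Y)) ⟨
      ∑[ x < v ] (2 * degree x + χ (∁ Y) x)     ≤⟨ sum-mono-≤ weighted-degree-bound ⟩
      ∑[ x < v ] (χ (∁ Y) x * w)                ≡⟨ *-distribʳ-sum w (χ (∁ Y)) ⟨
      sum (χ (∁ Y)) * w                         ≡⟨ cong (_* w) (∣p∣≡sum-χ (∁ Y)) ⟨
      w * w                                     ∎
      where
      open ≤-Reasoning
      w : ℕ
      w = ∣ ∁ Y ∣
      6∣C∣≡2∑degree : 6 * ∣ C ∣ ≡ 2 * sum degree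
      6∣C∣≡2∑degree = trans (*-assoc 2 3 ∣ C ∣) (cong (2 *_) (trans (*-comm 3 ∣ C ∣) (sym sum-degree)))

quadratic⇒BoundHolds : ∀ s w → 6 * s + w ≤ w * w → BoundHolds (s + w) s
quadratic⇒BoundHolds s w 6s+w≤w² = 2s≤2v+5 , (begin
  24 * (s + w) + 25                 ≡⟨ solve 2 (λ s w → con 24 :* (s :+ w) :+ con 25 := con 4 :* (con 6 :* s :+ w) :+ (con 20 :* w :+ con 25)) refl s w ⟩
  4 * (6 * s + w) + (20 * w + 25)   ≤⟨ +-monoˡ-≤ (20 * w + 25) (*-monoʳ-≤ 4 6s+w≤w²) ⟩
  4 * (w * w) + (20 * w + 25)       ≡⟨ solve 1 (λ w → con 4 :* (w :* w) :+ (con 20 :* w :+ con 25) := (con 2 :* w :+ con 5) :^ 2) refl w ⟩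
  (2 * w + 5) ^ 2                   ≡⟨ cong (_^ 2) 2v+5∸2s≡2w+5 ⟨
  (2 * (s + w) + 5 ∸ 2 * s) ^ 2     ∎)
  where
  open ≤-Reasoning
  2v+5≡2s+[2w+5] : 2 * (s + w) + 5 ≡ 2 * s + (2 * w + 5)
  2v+5≡2s+[2w+5] = solve 2 (λ s w → con 2 :* (s :+ w) :+ con 5 := con 2 :* s :+ (con 2 :* w :+ con 5)) refl s w
  2s≤2v+5 : 2 * s ≤ 2 * (s + w) + 5
  2s≤2v+5 = subst (2 * s ≤_) (sym 2v+5≡2s+[2w+5]) (m≤m+n (2 * s) (2 * w + 5))
  2v+5∸2s≡2w+5 : 2 * (s + w) + 5 ∸ 2 * s ≡ 2 * w + 5
  2v+5∸2s≡2w+5 = trans (cong (_∸ 2 * s) 2v+5≡2s+[2w+5]) (m+n∸m≡n (2 * s) (2 * w + 5))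

-- The congruence conditions on v only ensure that an STS(v) exists; the bound holds for every STS.
theorem3 : (v : ℕ) → 1 ≤ v → (v % 6 ≡ 1 ⊎ v % 6 ≡ 3) →
    (S : STS v) (Y : Subset v) (C : Subset (STS.b S)) →
    Nonincident S Y C → (s : ℕ) → ∣ Y ∣ ≡ s → ∣ C ∣ ≡ s →
    BoundHolds v s
theorem3 v _ _ S Y C nonincident s ∣Y∣≡s ∣C∣≡s =
  subst (λ u → BoundHolds u s) s+w≡v (quadratic⇒BoundHolds s w 6s+w≤w²)
  where
  open Counting S C
  w : ℕ
  w = ∣ ∁ Y ∣
  6s+w≤w² : 6 * s + w ≤ w * w
  6s+w≤w² = subst (λ c → 6 * c + w ≤ w * w) ∣C∣≡s (count-bound nonincident)
  s+w≡v : s + w ≡ v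
  s+w≡v = subst (λ t → t + w ≡ v) ∣Y∣≡s
            (trans (cong (∣ Y ∣ +_) (∣∁p∣≡n∸∣p∣ Y)) (m+[n∸m]≡n (∣p∣≤n Y)))
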